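{- Let $\alpha\in\Phi^+\setminus\Phi_p^+$ with $\langle\rho_p,\alpha^\vee\rangle<0$. Then there exists $\alpha_j\in\Delta_p$ such that $\alpha^\vee+\alpha_j^\vee=\beta^\vee$ for some $\beta\in\Phi^+\setminus\Phi_p^+$. In particular, if $w\in\mathfrak{W}_p$ and $\alpha\in(\Phi^+\setminus\Phi_p^+)\cap w^{ -1}\Phi^-$ satisfies $\langle\rho_p,\alpha^\vee\rangle<0$, then there exists $\alpha_j\in\Delta_p$ such that $\alpha^\vee+\alpha_j^\vee=\beta^\vee$ for some $\beta\in(\Phi^+\setminus\Phi_p^+)\cap w^{ -1}\Phi^-$.
   Context: Let $\Phi$ be a reduced irreducible root system of rank $r$ in a real inner product space, with fundamental system $\Delta=\{\alpha_1,\dots,\alpha_r\}$, positive roots $\Phi^+$, $\Phi^-=-\Phi^+$, coroots $\alpha^\vee=2\alpha/\langle\alpha,\alpha\rangle$, fundamental weights $\lambda_i$ with $\langle\lambda_i,\alpha_j^\vee\rangle=\delta_{ij}$, Weyl group $W$. Fix $1\le p\le r$; $\Delta_p=\Delta\setminus\{\alpha_p\}$, $\Phi_p=\{\alpha\in\Phi:\langle\lambda_p,\alpha^\vee\rangle=0\}$, $\Phi_p^+=\Phi_p\cap\Phi^+$, $\rho_p=\frac12\sum_{\alpha\in\Phi_p^+}\alpha$, $\mathfrak{W}_p=\{w\in W:\Delta_p\subset w^{ -1}(\Delta\cup\Phi^-)\}$.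
   Formalization: The root system lies in ℚ^r, with r its rank, and carries a rational symmetric positive-definite inner product, rather than lying in a real inner product space. -}

module Defs where

open import Level using (0ℓ)
open import Data.Nat using (ℕ; zero; suc)
open import Data.Integer using (ℤ)
open import Data.Fin using (Fin; zero; suc)
open import Data.Rational using (ℚ; 0ℚ; 1ℚ; ½; _+_; _*_; _-_; -_; _<_; _≤_; 1/_; _/_; ≢-nonZero)
open import Data.Rational.Properties using (_≟_)
open import Data.List using (List; []; _∷_; foldr)
open import Data.List.Relation.Unary.Any using (Any)
open import Data.List.Relation.Unary.All using (All)
open import Data.List.Relation.Unary.AllPairs using (AllPairs)
open import Data.Product using (Σ; ∃; ∃-syntax; _×_; _,_)
open import Data.Sum using (_⊎_)
open import Relation.Nullary using (¬_; yes; no)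
open import Relation.Binary.PropositionalEquality using (_≡_; _≢_)
open import Function.Bundles using (_⇔_)

Vect : ℕ → Set
Vect n = Fin n → ℚ

_≈ᵥ_ : ∀ {n} → Vect n → Vect n → Set
u ≈ᵥ v = ∀ i → u i ≡ v i
infix 4 _≈ᵥ_

0ᵥ : ∀ {n} → Vect n
0ᵥ _ = 0ℚ

_+ᵥ_ : ∀ {n} → Vect n → Vect n → Vect n
(u +ᵥ v) i = u i + v i
infixl 6 _+ᵥ_

_-ᵥ_ : ∀ {n} → Vect n → Vect n → Vect n
(u -ᵥ v) i = u i - v i
infixl 6 _-ᵥ_

-ᵥ_ : ∀ {n} → Vect n → Vect n
(-ᵥ u) i = - u i

_•_ : ∀ {n} → ℚ → Vect n → Vect n
(c • u) i = c * u i
infixr 7 _•_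

sumFin : ∀ {n} → (Fin n → ℚ) → ℚ
sumFin {zero}  f = 0ℚ
sumFin {suc n} f = f zero + sumFin (λ i → f (suc i))

sumᵥ : ∀ {n} → List (Vect n) → Vect n
sumᵥ = foldr _+ᵥ_ 0ᵥ

lincomb : ∀ {r n} → (Fin r → ℚ) → (Fin r → Vect n) → Vect n
lincomb c v j = sumFin (λ i → c i * v i j)

-- inverse of a rational, with the (irrelevant) convention 1/0 = 0
inv : ℚ → ℚ
inv q with q ≟ 0ℚ
... | yes _  = 0ℚ
... | no q≢0 = 1/_ q {{≢-nonZero q≢0}}

ℤ→ℚ : ℤ → ℚ
ℤ→ℚ z = z / 1

ℕ→ℚ : ℕ → ℚ
ℕ→ℚ n = ℤ→ℚ (Data.Integer.+ n)

record InnerProduct (n : ℕ) : Set where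
  field
    G      : Fin n → Fin n → ℚ
    G-sym  : ∀ i j → G i j ≡ G j i
    posdef : ∀ (v : Vect n) → ¬ (v ≈ᵥ 0ᵥ) →
             0ℚ < sumFin (λ i → sumFin (λ j → v i * G i j * v j))

module _ {n : ℕ} (B : InnerProduct n) where
  open InnerProduct B

  ipr : Vect n → Vect n → ℚ
  ipr u v = sumFin (λ i → sumFin (λ j → u i * G i j * v j))

  coroot : Vect n → Vect n
  coroot α = (ℕ→ℚ 2 * inv (ipr α α)) • α

  refl-s : Vect n → Vect n → Vect n
  refl-s α v = v -ᵥ (ipr v (coroot α) • α)

_∈ᵥ_ : ∀ {n} → Vect n → List (Vect n) → Set
v ∈ᵥ L = Any (λ u → v ≈ᵥ u) L

record RootSystem (r : ℕ) : Set₁ where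
  field
    ip      : InnerProduct r
    Φ       : List (Vect r)
    Φ-uniq  : AllPairs (λ u v → ¬ (u ≈ᵥ v)) Φ
    Φ-nonzero : ∀ α → α ∈ᵥ Φ → ¬ (α ≈ᵥ 0ᵥ)
    Φ-refl  : ∀ α β → α ∈ᵥ Φ → β ∈ᵥ Φ → refl-s ip α β ∈ᵥ Φ
    Φ-int   : ∀ α β → α ∈ᵥ Φ → β ∈ᵥ Φ → ∃[ z ] ipr ip β (coroot ip α) ≡ ℤ→ℚ z
    Φ-red   : ∀ α (c : ℚ) → α ∈ᵥ Φ → (c • α) ∈ᵥ Φ → c ≡ 1ℚ ⊎ c ≡ - 1ℚ
    Φ-ne    : ∃[ α ] α ∈ᵥ Φ
    Φ-irr   : ¬ (Σ (Vect r → Set) λ P →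
                  (∃[ α ] (α ∈ᵥ Φ × P α)) ×
                  (∃[ β ] (β ∈ᵥ Φ × ¬ P β)) ×
                  (∀ α β → α ∈ᵥ Φ → β ∈ᵥ Φ → P α → ¬ P β → ipr ip α β ≡ 0ℚ))
    Δ       : Fin r → Vect r
    Δ-root  : ∀ i → Δ i ∈ᵥ Φ
    Δ-indep : ∀ (c : Fin r → ℚ) → lincomb c Δ ≈ᵥ 0ᵥ → ∀ i → c i ≡ 0ℚ
    Δ-span  : ∀ β → β ∈ᵥ Φ → Σ (Fin r → ℕ) λ c → (β ≈ᵥ lincomb (λ i → ℕ→ℚ (c i)) Δ
                                     ⊎ β ≈ᵥ -ᵥ lincomb (λ i → ℕ→ℚ (c i)) Δ)

module RS {r : ℕ} (R : RootSystem r) where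
  open RootSystem R public

  ⟨_,_⟩ : Vect r → Vect r → ℚ
  ⟨ u , v ⟩ = ipr ip u v

  _^∨ : Vect r → Vect r
  α ^∨ = coroot ip α

  Pos : Vect r → Set
  Pos β = β ∈ᵥ Φ × Σ (Fin r → ℕ) λ c → (β ≈ᵥ lincomb (λ i → ℕ→ℚ (c i)) Δ)

  Neg : Vect r → Set
  Neg β = Pos (-ᵥ β)

  IsFundWeights : (Fin r → Vect r) → Set
  IsFundWeights λs = ∀ i j → ⟨ λs i , (Δ j) ^∨ ⟩ ≡ (δ i j)
    where
      δ : Fin r → Fin r → ℚ
      δ i j with Data.Fin._≟_ i j
      ... | yes _ = 1ℚ
      ... | no  _ = 0ℚ

  module _ (λs : Fin r → Vect r) (p : Fin r) where
    InΦp : Vect r → Set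
    InΦp α = α ∈ᵥ Φ × ⟨ λs p , α ^∨ ⟩ ≡ 0ℚ

    PosΦp : Vect r → Set
    PosΦp α = InΦp α × Pos α

    PosNotΦp : Vect r → Set
    PosNotΦp α = Pos α × ¬ PosΦp α

    IsRhoP : Vect r → Set
    IsRhoP ρ = ∃[ L ] (AllPairs (λ u v → ¬ (u ≈ᵥ v)) L ×
                       (∀ v → (v ∈ᵥ L ⇔ PosΦp v)) ×
                       ρ ≈ᵥ ½ • sumᵥ L)

  -- Weyl group elements, as words in reflections s_β (β ∈ Φ);
  -- a word [β₁,…,β_k] acts as s_β₁ ∘ ⋯ ∘ s_β_k.
  record WeylElt : Set where
    constructor weyl
    field
      word      : List (Vect r)
      word-root : All (λ β → β ∈ᵥ Φ) word

  act : WeylElt → Vect r → Vect r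
  act w v = foldr (refl-s ip) v (WeylElt.word w)

  -- 𝔚_p: Δ_p ⊆ w^{-1}(Δ ∪ Φ^-), i.e. for α_i ∈ Δ_p, w α_i ∈ Δ ∪ Φ^-
  InWp : Fin r → WeylElt → Set
  InWp p w = ∀ i → i ≢ p → (∃[ k ] act w (Δ i) ≈ᵥ Δ k) ⊎ Neg (act w (Δ i))

  InInvNeg : WeylElt → Vect r → Set
  InInvNeg w α = Neg (act w α)

-- Since ρ_p is half the sum of Φ_p^+, ⟨ ρ_p , α^∨ ⟩ < 0 forces ⟨ γ , α^∨ ⟩ < 0 for some
-- γ ∈ Φ_p^+, hence ⟨ α_j , α^∨ ⟩ < 0 for a simple root α_j occurring in γ, and j ≠ p because
-- roots of Φ_p have no α_p-component. As α is not proportional to α_j, the strict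
-- Cauchy–Schwarz inequality bounds the product of the negative Cartan integers
-- ⟨ α , α_j^∨ ⟩ ⟨ α_j , α^∨ ⟩ by 3, so one of them is -1 and the corresponding reflection,
-- s_{α_j} α or s_α α_j, is a root β = a α + b α_j (a, b ≥ 1) with β^∨ = α^∨ + α_j^∨. It is
-- positive, and ⟨ λ_p , β^∨ ⟩ = ⟨ λ_p , α^∨ ⟩ ≠ 0 keeps it out of Φ_p. For w ∈ 𝔚_p,
-- w β = a w α + b w α_j with w α negative and w α_j simple or negative; were w β positive,
-- then b w α_j = w β + a (-w α) would put -w α on the ray of the simple root w α_j, making
-- α proportional to α_j.

module Submission where

open import Defs

open import Level using (0ℓ)
open import Data.Nat as ℕ using (ℕ; zero; suc)
import Data.Nat.Properties as ℕ
open import Data.Nat.Coprimality as Coprime using (1-coprimeTo)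
import Data.Integer as ℤ
import Data.Integer.Properties as ℤ
import Data.Integer.GCD as ℤ
open import Data.Rational
import Data.Rational.Properties as ℚ
open import Data.Fin using (Fin; zero; suc)
import Data.Fin as Fin
import Data.Fin.Properties as Fin
open import Data.List using (List; []; _∷_)
open import Data.List.Relation.Unary.Any using (here; there)
import Data.List.Relation.Unary.Any as Any
open import Data.List.Relation.Unary.All using ([]; _∷_)
open import Data.Product using (Σ; ∃-syntax; _×_; _,_; proj₁; proj₂)
open import Data.Sum using (_⊎_; inj₁; inj₂; [_,_]′)
open import Data.Empty using (⊥; ⊥-elim)
import Data.Maybe as Maybe
open import Relation.Nullary using (¬_; yes; no)
open import Relation.Nullary.Decidable.Core using (dec⇒maybe)
open import Relation.Binary.PropositionalEquality
open import Function.Base using (_∘_; id)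
open import Function.Bundles using (Equivalence)
import Relation.Binary.Reasoning.Setoid as SetoidReasoning
open import Algebra.Bundles using (CommutativeRing)
import Algebra.Properties.Group ℚ.+-0-group as ℚ-Group
open import Algebra.Properties.Semiring.Sum (CommutativeRing.semiring ℚ.+-*-commutativeRing)
  using (sum; sum-cong-≗; ∑-distrib-+; ∑-comm; *-distribˡ-sum; sum-replicate-zero)
import Tactic.RingSolver.Core.AlmostCommutativeRing as ACR
open import Tactic.RingSolver using (solve-∀)

ℚ-ring : ACR.AlmostCommutativeRing 0ℓ 0ℓ
ℚ-ring = ACR.fromCommutativeRing ℚ.+-*-commutativeRing
  (λ x → Maybe.map sym (dec⇒maybe (x ℚ.≟ 0ℚ)))

two : ℚ
two = ℕ→ℚ 2

nonNeg*x<0⇒x<0 : ∀ {a b} → 0ℚ ≤ a → a * b < 0ℚ → b < 0ℚ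
nonNeg*x<0⇒x<0 {a} {b} 0≤a ab<0 =
  ℚ.*-cancelˡ-<-nonNeg a {{nonNegative 0≤a}} (subst (a * b <_) (sym (ℚ.*-zeroʳ a)) ab<0)

x*y<0⇒x≢0 : ∀ {a b} → a * b < 0ℚ → a ≢ 0ℚ
x*y<0⇒x≢0 {b = b} ab<0 refl = ℚ.<-irrefl (ℚ.*-zeroˡ b) ab<0

<⇒≱ : ∀ {a b} → a < b → b ≤ a → ⊥
<⇒≱ a<b b≤a = ℚ.<-irrefl refl (ℚ.<-≤-trans a<b b≤a)

x+y<0⇒x<0⊎y<0 : ∀ {a b} → a + b < 0ℚ → a < 0ℚ ⊎ b < 0ℚ
x+y<0⇒x<0⊎y<0 {a} {b} a+b<0 with a ℚ.<? 0ℚ | b ℚ.<? 0ℚ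
... | yes a<0 | _       = inj₁ a<0
... | no _    | yes b<0 = inj₂ b<0
... | no a≮0  | no b≮0  = ⊥-elim (<⇒≱ a+b<0 (ℚ.+-mono-≤ (ℚ.≮⇒≥ a≮0) (ℚ.≮⇒≥ b≮0)))

pos*pos⇒pos′ : ∀ {a b} → 0ℚ < a → 0ℚ < b → 0ℚ < a * b
pos*pos⇒pos′ {a} {b} 0<a 0<b =
  ℚ.positive⁻¹ (a * b) {{ℚ.pos*pos⇒pos a {{positive 0<a}} b {{positive 0<b}}}}

pos*neg⇒neg′ : ∀ {a b} → 0ℚ < a → b < 0ℚ → a * b < 0ℚ
pos*neg⇒neg′ {a} {b} 0<a b<0 =
  ℚ.negative⁻¹ (a * b) {{ℚ.pos*neg⇒neg a {{positive 0<a}} b {{negative b<0}}}}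

nonNeg*nonNeg⇒nonNeg′ : ∀ {a b} → 0ℚ ≤ a → 0ℚ ≤ b → 0ℚ ≤ a * b
nonNeg*nonNeg⇒nonNeg′ {a} {b} 0≤a 0≤b =
  ℚ.nonNegative⁻¹ (a * b) {{ℚ.nonNeg*nonNeg⇒nonNeg a {{nonNegative 0≤a}} b {{nonNegative 0≤b}}}}

inv-pos : ∀ {q} → 0ℚ < q → 0ℚ < inv q
inv-pos {q} 0<q with q ℚ.≟ 0ℚ
... | yes q≡0 = ⊥-elim (ℚ.<-irrefl (sym q≡0) 0<q)
... | no q≢0  = ℚ.positive⁻¹ _ {{ℚ.1/pos⇒pos q {{positive 0<q}}}}

inv-inverseˡ : ∀ {q} → q ≢ 0ℚ → inv q * q ≡ 1ℚ
inv-inverseˡ {q} q≢0 with q ℚ.≟ 0ℚ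
... | yes q≡0 = ⊥-elim (q≢0 q≡0)
... | no q≢0  = ℚ.*-inverseˡ q {{≢-nonZero q≢0}}

solve-linear : ∀ {k N a b} → k * N ≡ 1ℚ → N * a - b ≡ 0ℚ → a ≡ k * b
solve-linear {k} {N} {a} {b} kN≡1 Na-b≡0 = begin
  a                       ≡⟨ ℚ.*-identityˡ a ⟨
  1ℚ * a                  ≡⟨ cong (_* a) kN≡1 ⟨
  k * N * a               ≡⟨ split k N a b ⟩
  k * (N * a - b) + k * b ≡⟨ cong (λ y → k * y + k * b) Na-b≡0 ⟩
  k * 0ℚ + k * b          ≡⟨ cong (_+ k * b) (ℚ.*-zeroʳ k) ⟩
  0ℚ + k * b              ≡⟨ ℚ.+-identityˡ (k * b) ⟩
  k * b                   ∎
  where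
  open ≡-Reasoning
  split : ∀ k N a b → k * N * a ≡ k * (N * a - b) + k * b
  split = solve-∀ ℚ-ring

-- ℕ→ℚ n normalises n / 1 through a gcd, which does not compute for a variable n.
ℕ→ℚ-normal : ∀ n → ℕ→ℚ n ≡ mkℚ (ℤ.+ n) 0 (Coprime.sym (1-coprimeTo n))
ℕ→ℚ-normal n = ext ↥-normal ↧-normal
  where
  gcd≡1 : ℤ.gcd (ℤ.+ n) (ℤ.+ 1) ≡ ℤ.+ 1
  gcd≡1 = ℤ.gcd-zeroʳ (ℤ.+ n)
  ↥-normal : ↥ (ℕ→ℚ n) ≡ ℤ.+ n
  ↥-normal = trans (sym (ℤ.*-identityʳ _))
    (trans (cong (↥ (ℕ→ℚ n) ℤ.*_) (sym gcd≡1)) (ℚ.↥-/ (ℤ.+ n) 1))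
  ↧-normal : ↧ (ℕ→ℚ n) ≡ ℤ.+ 1
  ↧-normal = trans (sym (ℤ.*-identityʳ _))
    (trans (cong (↧ (ℕ→ℚ n) ℤ.*_) (sym gcd≡1)) (ℚ.↧-/ (ℤ.+ n) 1))
  ext : ∀ {p q} → ↥ p ≡ ↥ q → ↧ p ≡ ↧ q → p ≡ q
  ext {mkℚ _ _ _} {mkℚ _ _ _} refl refl = refl

ℕ→ℚ-homo-+ : ∀ m n → ℕ→ℚ (m ℕ.+ n) ≡ ℕ→ℚ m + ℕ→ℚ n
ℕ→ℚ-homo-+ m n rewrite ℕ→ℚ-normal m | ℕ→ℚ-normal n =
  cong (_/ 1) (cong₂ ℤ._+_ (sym (ℤ.*-identityʳ (ℤ.+ m))) (sym (ℤ.*-identityʳ (ℤ.+ n))))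

ℕ→ℚ-homo-* : ∀ m n → ℕ→ℚ (m ℕ.* n) ≡ ℕ→ℚ m * ℕ→ℚ n
ℕ→ℚ-homo-* m n rewrite ℕ→ℚ-normal m | ℕ→ℚ-normal n = cong (_/ 1) (sym (ℤ.+◃n≡+n (m ℕ.* n)))

ℕ→ℚ-injective : ∀ {m n} → ℕ→ℚ m ≡ ℕ→ℚ n → m ≡ n
ℕ→ℚ-injective {m} {n} e with trans (sym (ℕ→ℚ-normal m)) (trans e (ℕ→ℚ-normal n))
... | refl = refl

ℕ→ℚ-nonNeg : ∀ n → 0ℚ ≤ ℕ→ℚ n
ℕ→ℚ-nonNeg n rewrite ℕ→ℚ-normal n = ℚ.nonNegative⁻¹ _

ℕ→ℚ-pos : ∀ n → 0ℚ < ℕ→ℚ (suc n)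
ℕ→ℚ-pos n rewrite ℕ→ℚ-normal (suc n) = ℚ.positive⁻¹ _

ℕ→ℚ-mono-≤ : ∀ {m n} → m ℕ.≤ n → ℕ→ℚ m ≤ ℕ→ℚ n
ℕ→ℚ-mono-≤ {m} m≤n with ℕ.m≤n⇒∃[o]m+o≡n m≤n
... | k , refl = subst (_≤ ℕ→ℚ (m ℕ.+ k)) (ℚ.+-identityʳ (ℕ→ℚ m))
  (subst (ℕ→ℚ m + 0ℚ ≤_) (sym (ℕ→ℚ-homo-+ m k)) (ℚ.+-monoʳ-≤ (ℕ→ℚ m) (ℕ→ℚ-nonNeg k)))

ℤ→ℚ-neg : ∀ {z} → ℤ→ℚ z < 0ℚ → ∃[ m ] ℤ→ℚ z ≡ - ℕ→ℚ (suc m)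
ℤ→ℚ-neg {ℤ.+ n}     z<0 = ⊥-elim (<⇒≱ z<0 (ℕ→ℚ-nonNeg n))
ℤ→ℚ-neg {ℤ.-[1+ m ]} _  = m , refl

product<4⇒factor≡1 : ∀ m n → ℕ→ℚ (suc m) * ℕ→ℚ (suc n) < ℕ→ℚ 4 → m ≡ 0 ⊎ n ≡ 0
product<4⇒factor≡1 zero    n       _ = inj₁ refl
product<4⇒factor≡1 (suc m) zero    _ = inj₂ refl
product<4⇒factor≡1 (suc m) (suc n) mn<4 = ⊥-elim (<⇒≱ mn<4
  (subst (ℕ→ℚ 4 ≤_) (ℕ→ℚ-homo-* (2 ℕ.+ m) (2 ℕ.+ n))
    (ℕ→ℚ-mono-≤ (ℕ.*-mono-≤ (ℕ.m≤m+n 2 m) (ℕ.m≤m+n 2 n)))))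

sumFin≡sum : ∀ {n} (f : Fin n → ℚ) → sumFin f ≡ sum f
sumFin≡sum {zero}  f = refl
sumFin≡sum {suc n} f = cong (f zero +_) (sumFin≡sum (f ∘ suc))

sumFin-cong : ∀ {n} {f g : Fin n → ℚ} → (∀ i → f i ≡ g i) → sumFin f ≡ sumFin g
sumFin-cong {f = f} {g} f≗g = trans (sumFin≡sum f) (trans (sum-cong-≗ f≗g) (sym (sumFin≡sum g)))

sumFin-zero : ∀ n → sumFin {n} (λ _ → 0ℚ) ≡ 0ℚ
sumFin-zero n = trans (sumFin≡sum {n} (λ _ → 0ℚ)) (sum-replicate-zero n)

sumFin-distrib-+ : ∀ {n} (f g : Fin n → ℚ) → sumFin (λ i → f i + g i) ≡ sumFin f + sumFin g
sumFin-distrib-+ f g = begin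
  sumFin (λ i → f i + g i) ≡⟨ sumFin≡sum (λ i → f i + g i) ⟩
  sum (λ i → f i + g i)    ≡⟨ ∑-distrib-+ f g ⟩
  sum f + sum g            ≡⟨ cong₂ _+_ (sumFin≡sum f) (sumFin≡sum g) ⟨
  sumFin f + sumFin g      ∎
  where open ≡-Reasoning

*-distribˡ-sumFin : ∀ {n} c (f : Fin n → ℚ) → c * sumFin f ≡ sumFin (λ i → c * f i)
*-distribˡ-sumFin c f = begin
  c * sumFin f             ≡⟨ cong (c *_) (sumFin≡sum f) ⟩
  c * sum f                ≡⟨ *-distribˡ-sum c f ⟩
  sum (λ i → c * f i)      ≡⟨ sumFin≡sum (λ i → c * f i) ⟨
  sumFin (λ i → c * f i)   ∎
  where open ≡-Reasoning

sumFin-comm : ∀ {m n} (f : Fin m → Fin n → ℚ) →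
  sumFin (λ i → sumFin (λ j → f i j)) ≡ sumFin (λ j → sumFin (λ i → f i j))
sumFin-comm f = begin
  sumFin (λ i → sumFin (λ j → f i j)) ≡⟨ nested f ⟩
  sum (λ i → sum (λ j → f i j))       ≡⟨ ∑-comm f ⟩
  sum (λ j → sum (λ i → f i j))       ≡⟨ nested (λ j i → f i j) ⟨
  sumFin (λ j → sumFin (λ i → f i j)) ∎
  where
  open ≡-Reasoning
  nested : ∀ {k l} (g : Fin k → Fin l → ℚ) → sumFin (λ i → sumFin (g i)) ≡ sum (λ i → sum (g i))
  nested g = trans (sumFin≡sum (λ i → sumFin (g i))) (sum-cong-≗ (λ i → sumFin≡sum (g i)))

sumFin-nonNeg : ∀ {n} (f : Fin n → ℚ) → (∀ i → 0ℚ ≤ f i) → 0ℚ ≤ sumFin f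
sumFin-nonNeg {zero}  f 0≤f = ℚ.≤-refl
sumFin-nonNeg {suc n} f 0≤f = ℚ.+-mono-≤ (0≤f zero) (sumFin-nonNeg (f ∘ suc) (0≤f ∘ suc))

sumFin-pos : ∀ {n} (f : Fin n → ℚ) → (∀ i → 0ℚ ≤ f i) → ∀ k → 0ℚ < f k → 0ℚ < sumFin f
sumFin-pos f 0≤f zero    0<fk = ℚ.+-mono-<-≤ 0<fk (sumFin-nonNeg (f ∘ suc) (0≤f ∘ suc))
sumFin-pos f 0≤f (suc k) 0<fk = ℚ.+-mono-≤-< (0≤f zero) (sumFin-pos (f ∘ suc) (0≤f ∘ suc) k 0<fk)

sumFin<0⇒∃<0 : ∀ {n} (f : Fin n → ℚ) → sumFin f < 0ℚ → ∃[ i ] f i < 0ℚ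
sumFin<0⇒∃<0 {zero}  f Σ<0 = ⊥-elim (ℚ.<-irrefl refl Σ<0)
sumFin<0⇒∃<0 {suc n} f Σ<0 with x+y<0⇒x<0⊎y<0 Σ<0
... | inj₁ f₀<0 = zero , f₀<0
... | inj₂ Σ′<0 with sumFin<0⇒∃<0 (f ∘ suc) Σ′<0
...   | i , fi<0 = suc i , fi<0

-- Euclidean geometry of ℚⁿ

≈ᵥ-refl : ∀ {n} {u : Vect n} → u ≈ᵥ u
≈ᵥ-refl i = refl

≈ᵥ-sym : ∀ {n} {u v : Vect n} → u ≈ᵥ v → v ≈ᵥ u
≈ᵥ-sym u≈v i = sym (u≈v i)

≈ᵥ-trans : ∀ {n} {u v w : Vect n} → u ≈ᵥ v → v ≈ᵥ w → u ≈ᵥ w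
≈ᵥ-trans u≈v v≈w i = trans (u≈v i) (v≈w i)

module ≈ᵥ-Reasoning (n : ℕ) = SetoidReasoning (Fin n →-setoid ℚ)

Proportional : ∀ {n} → Vect n → Vect n → Set
Proportional u v = ∃[ c ] u ≈ᵥ c • v

module Euclidean {n : ℕ} (B : InnerProduct n) where
  open InnerProduct B

  ⟨_,_⟩ : Vect n → Vect n → ℚ
  ⟨ u , v ⟩ = ipr B u v

  ‖_‖² : Vect n → ℚ
  ‖ v ‖² = ⟨ v , v ⟩

  ‖‖²-pos : ∀ {v} → ¬ (v ≈ᵥ 0ᵥ) → 0ℚ < ‖ v ‖²
  ‖‖²-pos {v} = posdef v

  ipr-cong : ∀ {u u′ v v′} → u ≈ᵥ u′ → v ≈ᵥ v′ → ⟨ u , v ⟩ ≡ ⟨ u′ , v′ ⟩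
  ipr-cong u≈u′ v≈v′ = sumFin-cong λ i → sumFin-cong λ j →
    cong₂ (λ a b → a * G i j * b) (u≈u′ i) (v≈v′ j)

  ipr-sym : ∀ u v → ⟨ u , v ⟩ ≡ ⟨ v , u ⟩
  ipr-sym u v = trans (sumFin-comm (λ i j → u i * G i j * v j)) (sumFin-cong λ i → sumFin-cong λ j →
    trans (cong (λ g → u j * g * v i) (G-sym j i)) (swap (u j) (G i j) (v i)))
    where
    swap : ∀ a g b → a * g * b ≡ b * g * a
    swap = solve-∀ ℚ-ring

  ipr-+ˡ : ∀ u u′ v → ⟨ u +ᵥ u′ , v ⟩ ≡ ⟨ u , v ⟩ + ⟨ u′ , v ⟩
  ipr-+ˡ u u′ v = trans
    (sumFin-cong λ i → trans (sumFin-cong λ j → distrib (u i) (u′ i) (G i j) (v j))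
                             (sumFin-distrib-+ (λ j → u i * G i j * v j) (λ j → u′ i * G i j * v j)))
    (sumFin-distrib-+ (λ i → sumFin λ j → u i * G i j * v j) (λ i → sumFin λ j → u′ i * G i j * v j))
    where
    distrib : ∀ a a′ g b → (a + a′) * g * b ≡ a * g * b + a′ * g * b
    distrib = solve-∀ ℚ-ring

  ipr-•ˡ : ∀ c u v → ⟨ c • u , v ⟩ ≡ c * ⟨ u , v ⟩
  ipr-•ˡ c u v = trans
    (sumFin-cong λ i → trans (sumFin-cong λ j → assoc c (u i) (G i j) (v j))
                             (sym (*-distribˡ-sumFin c (λ j → u i * G i j * v j))))
    (sym (*-distribˡ-sumFin c (λ i → sumFin λ j → u i * G i j * v j)))
    where
    assoc : ∀ c a g b → c * a * g * b ≡ c * (a * g * b)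
    assoc = solve-∀ ℚ-ring

  ipr-+ʳ : ∀ u v v′ → ⟨ u , v +ᵥ v′ ⟩ ≡ ⟨ u , v ⟩ + ⟨ u , v′ ⟩
  ipr-+ʳ u v v′ = trans (ipr-sym u _) (trans (ipr-+ˡ v v′ u) (cong₂ _+_ (ipr-sym v u) (ipr-sym v′ u)))

  ipr-•ʳ : ∀ c u v → ⟨ u , c • v ⟩ ≡ c * ⟨ u , v ⟩
  ipr-•ʳ c u v = trans (ipr-sym u _) (trans (ipr-•ˡ c v u) (cong (c *_) (ipr-sym v u)))

  ipr-0ˡ : ∀ v → ⟨ 0ᵥ , v ⟩ ≡ 0ℚ
  ipr-0ˡ v = trans (ipr-•ˡ 0ℚ 0ᵥ v) (ℚ.*-zeroˡ ⟨ 0ᵥ , v ⟩)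

  ipr-subˡ : ∀ u u′ v → ⟨ u -ᵥ u′ , v ⟩ ≡ ⟨ u , v ⟩ - ⟨ u′ , v ⟩
  ipr-subˡ u u′ v = begin
    ⟨ u -ᵥ u′ , v ⟩                  ≡⟨ ipr-cong (λ i → sub (u i) (u′ i)) ≈ᵥ-refl ⟩
    ⟨ u +ᵥ (- 1ℚ) • u′ , v ⟩         ≡⟨ ipr-+ˡ u _ v ⟩
    ⟨ u , v ⟩ + ⟨ (- 1ℚ) • u′ , v ⟩  ≡⟨ cong (⟨ u , v ⟩ +_) (ipr-•ˡ (- 1ℚ) u′ v) ⟩
    ⟨ u , v ⟩ + (- 1ℚ) * ⟨ u′ , v ⟩  ≡⟨ sub ⟨ u , v ⟩ ⟨ u′ , v ⟩ ⟨
    ⟨ u , v ⟩ - ⟨ u′ , v ⟩           ∎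
    where
    open ≡-Reasoning
    sub : ∀ a b → a - b ≡ a + (- 1ℚ) * b
    sub = solve-∀ ℚ-ring

  ipr-subʳ : ∀ u v v′ → ⟨ u , v -ᵥ v′ ⟩ ≡ ⟨ u , v ⟩ - ⟨ u , v′ ⟩
  ipr-subʳ u v v′ = trans (ipr-sym u _) (trans (ipr-subˡ v v′ u) (cong₂ _-_ (ipr-sym v u) (ipr-sym v′ u)))

  ipr-•• : ∀ a c u v → ⟨ a • u , c • v ⟩ ≡ a * c * ⟨ u , v ⟩
  ipr-•• a c u v = trans (ipr-•ˡ a u _) (trans (cong (a *_) (ipr-•ʳ c u v)) (sym (ℚ.*-assoc a c _)))

  ipr-expand : ∀ a b c d u v u′ v′ →
    ⟨ a • u -ᵥ b • v , c • u′ -ᵥ d • v′ ⟩ ≡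
    a * c * ⟨ u , u′ ⟩ - a * d * ⟨ u , v′ ⟩ - (b * c * ⟨ u′ , v ⟩ - b * d * ⟨ v , v′ ⟩)
  ipr-expand a b c d u v u′ v′ = begin
    ⟨ a • u -ᵥ b • v , c • u′ -ᵥ d • v′ ⟩
      ≡⟨ ipr-subˡ (a • u) (b • v) _ ⟩
    ⟨ a • u , c • u′ -ᵥ d • v′ ⟩ - ⟨ b • v , c • u′ -ᵥ d • v′ ⟩
      ≡⟨ cong₂ _-_ (ipr-subʳ (a • u) _ _) (ipr-subʳ (b • v) _ _) ⟩
    ⟨ a • u , c • u′ ⟩ - ⟨ a • u , d • v′ ⟩ - (⟨ b • v , c • u′ ⟩ - ⟨ b • v , d • v′ ⟩)
      ≡⟨ cong₂ _-_ (cong₂ _-_ (ipr-•• a c u u′) (ipr-•• a d u v′))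
                   (cong₂ _-_ (trans (ipr-•• b c v u′) (cong (b * c *_) (ipr-sym v u′)))
                              (ipr-•• b d v v′)) ⟩
    a * c * ⟨ u , u′ ⟩ - a * d * ⟨ u , v′ ⟩ - (b * c * ⟨ u′ , v ⟩ - b * d * ⟨ v , v′ ⟩) ∎
    where open ≡-Reasoning

  ipr-lincombˡ : ∀ {m} (c : Fin m → ℚ) (v : Fin m → Vect n) w →
    ⟨ lincomb c v , w ⟩ ≡ sumFin (λ i → c i * ⟨ v i , w ⟩)
  ipr-lincombˡ {zero}  c v w = ipr-0ˡ w
  ipr-lincombˡ {suc m} c v w = begin
    ⟨ c zero • v zero +ᵥ lincomb (c ∘ suc) (v ∘ suc) , w ⟩
      ≡⟨ ipr-+ˡ (c zero • v zero) _ w ⟩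
    ⟨ c zero • v zero , w ⟩ + ⟨ lincomb (c ∘ suc) (v ∘ suc) , w ⟩
      ≡⟨ cong₂ _+_ (ipr-•ˡ (c zero) (v zero) w) (ipr-lincombˡ (c ∘ suc) (v ∘ suc) w) ⟩
    c zero * ⟨ v zero , w ⟩ + sumFin (λ i → c (suc i) * ⟨ v (suc i) , w ⟩) ∎
    where open ≡-Reasoning

  ipr-lincombʳ : ∀ {m} (c : Fin m → ℚ) (v : Fin m → Vect n) w →
    ⟨ w , lincomb c v ⟩ ≡ sumFin (λ i → c i * ⟨ w , v i ⟩)
  ipr-lincombʳ c v w = trans (ipr-sym w _) (trans (ipr-lincombˡ c v w)
    (sumFin-cong λ i → cong (c i *_) (ipr-sym (v i) w)))

  ipr-sumᵥ<0⇒∃<0 : ∀ L v → ⟨ sumᵥ L , v ⟩ < 0ℚ → ∃[ γ ] (γ ∈ᵥ L × ⟨ γ , v ⟩ < 0ℚ)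
  ipr-sumᵥ<0⇒∃<0 []      v Σ<0 = ⊥-elim (ℚ.<-irrefl (ipr-0ˡ v) Σ<0)
  ipr-sumᵥ<0⇒∃<0 (γ ∷ L) v Σ<0 with x+y<0⇒x<0⊎y<0 (subst (_< 0ℚ) (ipr-+ˡ γ (sumᵥ L) v) Σ<0)
  ... | inj₁ γ<0 = γ , here ≈ᵥ-refl , γ<0
  ... | inj₂ L<0 with ipr-sumᵥ<0⇒∃<0 L v L<0
  ...   | δ , δ∈L , δ<0 = δ , there δ∈L , δ<0

  ipr-lincomb<0⇒∃<0 : ∀ {m} (c : Fin m → ℕ) (v : Fin m → Vect n) w →
    ⟨ lincomb (λ i → ℕ→ℚ (c i)) v , w ⟩ < 0ℚ → ∃[ i ] (c i ≢ 0 × ⟨ v i , w ⟩ < 0ℚ)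
  ipr-lincomb<0⇒∃<0 c v w Σ<0 =
    let i , term<0 = sumFin<0⇒∃<0 (λ i → ℕ→ℚ (c i) * ⟨ v i , w ⟩)
                       (subst (_< 0ℚ) (ipr-lincombˡ (λ i → ℕ→ℚ (c i)) v w) Σ<0)
    in i , (λ ci≡0 → x*y<0⇒x≢0 term<0 (cong ℕ→ℚ ci≡0)) , nonNeg*x<0⇒x<0 (ℕ→ℚ-nonNeg (c i)) term<0

  ‖‖²≡0⇒¬¬≈0 : ∀ {v} → ‖ v ‖² ≡ 0ℚ → ¬ ¬ (v ≈ᵥ 0ᵥ)
  ‖‖²≡0⇒¬¬≈0 {v} ‖v‖²≡0 v≉0 = ℚ.<-irrefl (sym ‖v‖²≡0) (‖‖²-pos v≉0)

  cauchy-schwarz-strict : ∀ {u γ} → ¬ (γ ≈ᵥ 0ᵥ) → ¬ Proportional u γ →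
    ⟨ u , γ ⟩ * ⟨ u , γ ⟩ < ‖ u ‖² * ‖ γ ‖²
  cauchy-schwarz-strict {u} {γ} γ≉0 u∦γ =
    ℚ.*-cancelˡ-<-nonNeg N {{nonNegative (ℚ.<⇒≤ (‖‖²-pos γ≉0))}} (begin-strict
      N * (x * x)            ≡⟨ ℚ.+-identityˡ _ ⟨
      0ℚ + N * (x * x)       <⟨ ℚ.+-monoˡ-< (N * (x * x)) (‖‖²-pos v≉0) ⟩
      ‖ v ‖² + N * (x * x)   ≡⟨ cong (_+ N * (x * x)) (ipr-expand N x N x u γ u γ) ⟩
      N * N * ‖ u ‖² - N * x * x - (x * N * x - x * x * N) + N * (x * x)
                             ≡⟨ expand N x ‖ u ‖² ⟩
      N * (‖ u ‖² * N)       ∎)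
    where
    open ℚ.≤-Reasoning
    N = ‖ γ ‖²
    x = ⟨ u , γ ⟩
    -- N times the component of u orthogonal to γ
    v = N • u -ᵥ x • γ
    expand : ∀ N x U → N * N * U - N * x * x - (x * N * x - x * x * N) + N * (x * x) ≡ N * (U * N)
    expand = solve-∀ ℚ-ring
    v≉0 : ¬ (v ≈ᵥ 0ᵥ)
    v≉0 v≈0 = u∦γ (inv N * x , λ i →
      trans (solve-linear {inv N} {N} (inv-inverseˡ (ℚ.<⇒≢ (‖‖²-pos γ≉0) ∘ sym)) (v≈0 i))
            (sym (ℚ.*-assoc (inv N) x (γ i))))

  _^∨ : Vect n → Vect n
  _^∨ = coroot B

  2/‖_‖² : Vect n → ℚ
  2/‖ α ‖² = two * inv ‖ α ‖²

  coroot-pairing : ∀ v α → ⟨ v , α ^∨ ⟩ ≡ 2/‖ α ‖² * ⟨ v , α ⟩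
  coroot-pairing v α = ipr-•ʳ 2/‖ α ‖² v α

  2/‖‖²-pos : ∀ {α} → ¬ (α ≈ᵥ 0ᵥ) → 0ℚ < 2/‖ α ‖²
  2/‖‖²-pos {α} α≉0 = pos*pos⇒pos′ (ℚ.positive⁻¹ two) (inv-pos (‖‖²-pos α≉0))

  2/‖‖²*‖‖² : ∀ {α} → ¬ (α ≈ᵥ 0ᵥ) → 2/‖ α ‖² * ‖ α ‖² ≡ two
  2/‖‖²*‖‖² {α} α≉0 = begin
    two * inv ‖ α ‖² * ‖ α ‖²   ≡⟨ ℚ.*-assoc two (inv ‖ α ‖²) ‖ α ‖² ⟩
    two * (inv ‖ α ‖² * ‖ α ‖²) ≡⟨ cong (two *_) (inv-inverseˡ (ℚ.<⇒≢ (‖‖²-pos α≉0) ∘ sym)) ⟩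
    two * 1ℚ                    ≡⟨ ℚ.*-identityʳ two ⟩
    two                         ∎
    where open ≡-Reasoning

  coroot-self : ∀ {α} → ¬ (α ≈ᵥ 0ᵥ) → ⟨ α , α ^∨ ⟩ ≡ two
  coroot-self {α} α≉0 = trans (coroot-pairing α α) (2/‖‖²*‖‖² α≉0)

  pairing-via-coroot : ∀ {α} → ¬ (α ≈ᵥ 0ᵥ) → ∀ v → ⟨ v , α ⟩ ≡ ½ * ‖ α ‖² * ⟨ v , α ^∨ ⟩
  pairing-via-coroot {α} α≉0 v = sym (begin
    ½ * ‖ α ‖² * ⟨ v , α ^∨ ⟩           ≡⟨ cong (½ * ‖ α ‖² *_) (coroot-pairing v α) ⟩
    ½ * ‖ α ‖² * (2/‖ α ‖² * ⟨ v , α ⟩) ≡⟨ regroup ½ ‖ α ‖² 2/‖ α ‖² ⟨ v , α ⟩ ⟩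
    ½ * (2/‖ α ‖² * ‖ α ‖²) * ⟨ v , α ⟩ ≡⟨ cong (λ y → ½ * y * ⟨ v , α ⟩) (2/‖‖²*‖‖² α≉0) ⟩
    ½ * two * ⟨ v , α ⟩                 ≡⟨ ℚ.*-identityˡ ⟨ v , α ⟩ ⟩
    ⟨ v , α ⟩                           ∎)
    where
    open ≡-Reasoning
    regroup : ∀ h N k x → h * N * (k * x) ≡ h * (k * N) * x
    regroup = solve-∀ ℚ-ring

  coroot-pairing-neg-sym : ∀ {α γ} → ¬ (α ≈ᵥ 0ᵥ) → ¬ (γ ≈ᵥ 0ᵥ) →
    ⟨ γ , α ^∨ ⟩ < 0ℚ → ⟨ α , γ ^∨ ⟩ < 0ℚ
  coroot-pairing-neg-sym {α} {γ} α≉0 γ≉0 γα∨<0 =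
    subst (_< 0ℚ) (sym (coroot-pairing α γ)) (pos*neg⇒neg′ (2/‖‖²-pos γ≉0)
      (subst (_< 0ℚ) (sym (trans (ipr-sym α γ) (pairing-via-coroot α≉0 γ)))
        (pos*neg⇒neg′ (pos*pos⇒pos′ (ℚ.positive⁻¹ ½) (‖‖²-pos α≉0)) γα∨<0)))

  pairing-coroot-proportional : ∀ {v γ α c} → ⟨ v , γ ⟩ ≡ 0ℚ → α ≈ᵥ c • γ → ⟨ v , α ^∨ ⟩ ≡ 0ℚ
  pairing-coroot-proportional {v} {γ} {α} {c} vγ≡0 α≈cγ = begin
    ⟨ v , α ^∨ ⟩                 ≡⟨ coroot-pairing v α ⟩
    2/‖ α ‖² * ⟨ v , α ⟩         ≡⟨ cong (2/‖ α ‖² *_) (ipr-cong {v} ≈ᵥ-refl α≈cγ) ⟩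
    2/‖ α ‖² * ⟨ v , c • γ ⟩     ≡⟨ cong (2/‖ α ‖² *_) (ipr-•ʳ c v γ) ⟩
    2/‖ α ‖² * (c * ⟨ v , γ ⟩)   ≡⟨ cong (λ y → 2/‖ α ‖² * (c * y)) vγ≡0 ⟩
    2/‖ α ‖² * (c * 0ℚ)          ≡⟨ cong (2/‖ α ‖² *_) (ℚ.*-zeroʳ c) ⟩
    2/‖ α ‖² * 0ℚ                ≡⟨ ℚ.*-zeroʳ 2/‖ α ‖² ⟩
    0ℚ                           ∎
    where open ≡-Reasoning

  cartan-product<4 : ∀ {α γ} → ¬ (α ≈ᵥ 0ᵥ) → ¬ (γ ≈ᵥ 0ᵥ) → ¬ Proportional α γ →
    ⟨ α , γ ^∨ ⟩ * ⟨ γ , α ^∨ ⟩ < ℕ→ℚ 4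
  cartan-product<4 {α} {γ} α≉0 γ≉0 α∦γ = begin-strict
    ⟨ α , γ ^∨ ⟩ * ⟨ γ , α ^∨ ⟩           ≡⟨ cong₂ _*_ (coroot-pairing α γ) (coroot-pairing γ α) ⟩
    (kγ * ⟨ α , γ ⟩) * (kα * ⟨ γ , α ⟩)  ≡⟨ cong (λ y → (kγ * ⟨ α , γ ⟩) * (kα * y)) (ipr-sym γ α) ⟩
    (kγ * ⟨ α , γ ⟩) * (kα * ⟨ α , γ ⟩)  ≡⟨ regroup kγ kα ⟨ α , γ ⟩ ⟩
    (kα * kγ) * (⟨ α , γ ⟩ * ⟨ α , γ ⟩)  <⟨ ℚ.*-monoʳ-<-pos (kα * kγ) {{positive 0<kαkγ}}
                                               (cauchy-schwarz-strict γ≉0 α∦γ) ⟩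
    (kα * kγ) * (‖ α ‖² * ‖ γ ‖²)        ≡⟨ regroup′ kα kγ ‖ α ‖² ‖ γ ‖² ⟩
    (kα * ‖ α ‖²) * (kγ * ‖ γ ‖²)        ≡⟨ cong₂ _*_ (2/‖‖²*‖‖² α≉0) (2/‖‖²*‖‖² γ≉0) ⟩
    two * two                            ∎
    where
    open ℚ.≤-Reasoning
    kα = 2/‖ α ‖²
    kγ = 2/‖ γ ‖²
    0<kαkγ : 0ℚ < kα * kγ
    0<kαkγ = pos*pos⇒pos′ (2/‖‖²-pos α≉0) (2/‖‖²-pos γ≉0)
    regroup : ∀ k k′ x → (k * x) * (k′ * x) ≡ (k′ * k) * (x * x)
    regroup = solve-∀ ℚ-ring
    regroup′ : ∀ k k′ N N′ → (k * k′) * (N * N′) ≡ (k * N) * (k′ * N′)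
    regroup′ = solve-∀ ℚ-ring

  s : Vect n → Vect n → Vect n
  s = refl-s B

  s-cong : ∀ γ {u v} → u ≈ᵥ v → s γ u ≈ᵥ s γ v
  s-cong γ u≈v i = cong₂ (λ a b → a - b * γ i) (u≈v i) (ipr-cong u≈v ≈ᵥ-refl)

  s-+ : ∀ γ u v → s γ (u +ᵥ v) ≈ᵥ s γ u +ᵥ s γ v
  s-+ γ u v i = trans (cong (λ y → u i + v i - y * γ i) (ipr-+ˡ u v (γ ^∨)))
    (distrib (u i) (v i) ⟨ u , γ ^∨ ⟩ ⟨ v , γ ^∨ ⟩ (γ i))
    where
    distrib : ∀ a b x y g → a + b - (x + y) * g ≡ (a - x * g) + (b - y * g)
    distrib = solve-∀ ℚ-ring

  s-• : ∀ γ c v → s γ (c • v) ≈ᵥ c • s γ v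
  s-• γ c v i = trans (cong (λ y → c * v i - y * γ i) (ipr-•ˡ c v (γ ^∨)))
    (distrib c (v i) ⟨ v , γ ^∨ ⟩ (γ i))
    where
    distrib : ∀ c a x g → c * a - (c * x) * g ≡ c * (a - x * g)
    distrib = solve-∀ ℚ-ring

  s-self : ∀ {γ} → ¬ (γ ≈ᵥ 0ᵥ) → s γ γ ≈ᵥ -ᵥ γ
  s-self {γ} γ≉0 i = trans (cong (λ y → γ i - y * γ i) (coroot-self γ≉0)) (a-2a (γ i))
    where
    a-2a : ∀ a → a - (1ℚ + 1ℚ) * a ≡ - a
    a-2a = solve-∀ ℚ-ring

  s-iso : ∀ {γ} → ¬ (γ ≈ᵥ 0ᵥ) → ∀ u v → ⟨ s γ u , s γ v ⟩ ≡ ⟨ u , v ⟩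
  s-iso {γ} γ≉0 u v = begin
    ⟨ s γ u , s γ v ⟩
      ≡⟨ ipr-cong (unit-scale u) (unit-scale v) ⟩
    ⟨ 1ℚ • u -ᵥ (k * xu) • γ , 1ℚ • v -ᵥ (k * xv) • γ ⟩
      ≡⟨ ipr-expand 1ℚ (k * xu) 1ℚ (k * xv) u γ v γ ⟩
    1ℚ * 1ℚ * ⟨ u , v ⟩ - 1ℚ * (k * xv) * xu - ((k * xu) * 1ℚ * xv - (k * xu) * (k * xv) * N)
      ≡⟨ expand ⟨ u , v ⟩ k xu xv N ⟩
    ⟨ u , v ⟩ + k * xu * xv * (k * N - (1ℚ + 1ℚ))
      ≡⟨ cong (λ y → ⟨ u , v ⟩ + k * xu * xv * (y - (1ℚ + 1ℚ))) (2/‖‖²*‖‖² γ≉0) ⟩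
    ⟨ u , v ⟩ + k * xu * xv * ((1ℚ + 1ℚ) - (1ℚ + 1ℚ))
      ≡⟨ vanish ⟨ u , v ⟩ (k * xu * xv) ⟩
    ⟨ u , v ⟩ ∎
    where
    open ≡-Reasoning
    k = 2/‖ γ ‖²
    N = ‖ γ ‖²
    xu = ⟨ u , γ ⟩
    xv = ⟨ v , γ ⟩
    unit-scale : ∀ w → s γ w ≈ᵥ 1ℚ • w -ᵥ (k * ⟨ w , γ ⟩) • γ
    unit-scale w i = cong₂ (λ a y → a - y * γ i) (sym (ℚ.*-identityˡ (w i))) (coroot-pairing w γ)
    expand : ∀ uv k xu xv N →
      1ℚ * 1ℚ * uv - 1ℚ * (k * xv) * xu - ((k * xu) * 1ℚ * xv - (k * xu) * (k * xv) * N)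
      ≡ uv + k * xu * xv * (k * N - (1ℚ + 1ℚ))
    expand = solve-∀ ℚ-ring
    vanish : ∀ a b → a + b * ((1ℚ + 1ℚ) - (1ℚ + 1ℚ)) ≡ a
    vanish = solve-∀ ℚ-ring

  coroot-s : ∀ {γ} → ¬ (γ ≈ᵥ 0ᵥ) → ∀ v → (s γ v) ^∨ ≈ᵥ v ^∨ -ᵥ ⟨ v ^∨ , γ ⟩ • γ ^∨
  coroot-s {γ} γ≉0 v i = begin
    two * inv ‖ s γ v ‖² * (v i - ⟨ v , γ ^∨ ⟩ * γ i)
      ≡⟨ cong₂ (λ N y → two * inv N * (v i - y * γ i)) (s-iso γ≉0 v v) (coroot-pairing v γ) ⟩
    kv * (v i - (kγ * ⟨ v , γ ⟩) * γ i)
      ≡⟨ regroup kv kγ ⟨ v , γ ⟩ (v i) (γ i) ⟩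
    kv * v i - (kv * ⟨ v , γ ⟩) * (kγ * γ i)
      ≡⟨ cong (λ y → kv * v i - y * (kγ * γ i)) (ipr-•ˡ kv v γ) ⟨
    kv * v i - ⟨ v ^∨ , γ ⟩ * (kγ * γ i) ∎
    where
    open ≡-Reasoning
    kv = 2/‖ v ‖²
    kγ = 2/‖ γ ‖²
    regroup : ∀ k k′ x a g → k * (a - (k′ * x) * g) ≡ k * a - (k * x) * (k′ * g)
    regroup = solve-∀ ℚ-ring

-- Cones spanned by a finite family of vectors

Independent : ∀ {m n} → (Fin m → Vect n) → Set
Independent v = ∀ c → lincomb c v ≈ᵥ 0ᵥ → ∀ i → c i ≡ 0ℚ

single : ∀ {m} → Fin m → ℕ → Fin m → ℕ
single zero    u zero    = u
single zero    u (suc i) = 0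
single (suc k) u zero    = 0
single (suc k) u (suc i) = single k u i

single-≢ : ∀ {m} (k i : Fin m) u → i ≢ k → single k u i ≡ 0
single-≢ zero    zero    u i≢k = ⊥-elim (i≢k refl)
single-≢ zero    (suc i) u i≢k = refl
single-≢ (suc k) zero    u i≢k = refl
single-≢ (suc k) (suc i) u i≢k = single-≢ k i u (i≢k ∘ cong suc)

supported-single : ∀ {m} (k : Fin m) (c : Fin m → ℕ) → (∀ i → i ≢ k → c i ≡ 0) →
  ∀ i → c i ≡ single k (c k) i
supported-single zero    c c≡0 zero    = refl
supported-single zero    c c≡0 (suc i) = c≡0 (suc i) λ ()
supported-single (suc k) c c≡0 zero    = c≡0 zero λ ()
supported-single (suc k) c c≡0 (suc i) =
  supported-single k (c ∘ suc) (λ i i≢k → c≡0 (suc i) (i≢k ∘ Fin.suc-injective)) i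

lincomb-single : ∀ {m n} (v : Fin m → Vect n) k u →
  lincomb (λ i → ℕ→ℚ (single k u i)) v ≈ᵥ ℕ→ℚ u • v k
lincomb-single {suc m} v zero u j = begin
  ℕ→ℚ u * v zero j + sumFin (λ i → 0ℚ * v (suc i) j) ≡⟨ cong (ℕ→ℚ u * v zero j +_) rest≡0 ⟩
  ℕ→ℚ u * v zero j + 0ℚ                              ≡⟨ ℚ.+-identityʳ _ ⟩
  ℕ→ℚ u * v zero j                                   ∎
  where
  open ≡-Reasoning
  rest≡0 : sumFin (λ i → 0ℚ * v (suc i) j) ≡ 0ℚ
  rest≡0 = trans (sumFin-cong λ i → ℚ.*-zeroˡ (v (suc i) j)) (sumFin-zero m)
lincomb-single {suc m} v (suc k) u j = begin
  0ℚ * v zero j + rest ≡⟨ cong (_+ rest) (ℚ.*-zeroˡ (v zero j)) ⟩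
  0ℚ + rest            ≡⟨ ℚ.+-identityˡ rest ⟩
  rest                 ≡⟨ lincomb-single (v ∘ suc) k u j ⟩
  ℕ→ℚ u * v (suc k) j  ∎
  where
  open ≡-Reasoning
  rest = lincomb (λ i → ℕ→ℚ (single k u i)) (v ∘ suc) j

module _ {m n} (v : Fin m → Vect n) where

  lincomb-cong : ∀ {c c′} → (∀ i → c i ≡ c′ i) → lincomb c v ≈ᵥ lincomb c′ v
  lincomb-cong c≗c′ j = sumFin-cong λ i → cong (_* v i j) (c≗c′ i)

  lincomb-+ : ∀ c c′ → lincomb c v +ᵥ lincomb c′ v ≈ᵥ lincomb (λ i → c i + c′ i) v
  lincomb-+ c c′ j = trans (sym (sumFin-distrib-+ (λ i → c i * v i j) (λ i → c′ i * v i j)))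
    (sumFin-cong λ i → sym (ℚ.*-distribʳ-+ (v i j) (c i) (c′ i)))

  lincomb-• : ∀ a c → a • lincomb c v ≈ᵥ lincomb (λ i → a * c i) v
  lincomb-• a c j = trans (*-distribˡ-sumFin a (λ i → c i * v i j))
    (sumFin-cong λ i → sym (ℚ.*-assoc a (c i) (v i j)))

  lincomb-injective : Independent v → ∀ {c c′} → lincomb c v ≈ᵥ lincomb c′ v → ∀ i → c i ≡ c′ i
  lincomb-injective indep {c} {c′} c≈c′ i = ℚ-Group.x∙y⁻¹≈ε⇒x≈y (c i) (c′ i)
    (indep (λ i → c i - c′ i) difference≈0 i)
    where
    difference≈0 : lincomb (λ i → c i - c′ i) v ≈ᵥ 0ᵥ
    difference≈0 j = begin
      lincomb (λ i → c i - c′ i) v j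
        ≡⟨ lincomb-cong (λ i → cong (c i +_) (negate (c′ i))) j ⟩
      lincomb (λ i → c i + - 1ℚ * c′ i) v j
        ≡⟨ lincomb-+ c (λ i → - 1ℚ * c′ i) j ⟨
      lincomb c v j + lincomb (λ i → - 1ℚ * c′ i) v j
        ≡⟨ cong (lincomb c v j +_) (lincomb-• (- 1ℚ) c′ j) ⟨
      lincomb c v j + - 1ℚ * lincomb c′ v j
        ≡⟨ cong (λ y → lincomb c v j + - 1ℚ * y) (c≈c′ j) ⟨
      lincomb c v j + - 1ℚ * lincomb c v j
        ≡⟨ cancel (lincomb c v j) ⟩
      0ℚ ∎
      where
      open ≡-Reasoning
      negate : ∀ x → - x ≡ - 1ℚ * x
      negate = solve-∀ ℚ-ring
      cancel : ∀ x → x + - 1ℚ * x ≡ 0ℚ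
      cancel = solve-∀ ℚ-ring

  InCone : Vect n → Set
  InCone u = Σ (Fin m → ℕ) λ c → u ≈ᵥ lincomb (λ i → ℕ→ℚ (c i)) v

  cone-generator : ∀ k → InCone (v k)
  cone-generator k =
    single k 1 , λ j → trans (sym (ℚ.*-identityˡ (v k j))) (sym (lincomb-single v k 1 j))

  cone-comb : ∀ a b {u w} → InCone u → InCone w → InCone (ℕ→ℚ a • u +ᵥ ℕ→ℚ b • w)
  cone-comb a b {u} {w} (c , u≈c) (d , w≈d) = (λ i → a ℕ.* c i ℕ.+ b ℕ.* d i) , (begin
    ℕ→ℚ a • u +ᵥ ℕ→ℚ b • w
      ≈⟨ (λ j → cong₂ (λ x y → ℕ→ℚ a * x + ℕ→ℚ b * y) (u≈c j) (w≈d j)) ⟩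
    ℕ→ℚ a • lincomb (λ i → ℕ→ℚ (c i)) v +ᵥ ℕ→ℚ b • lincomb (λ i → ℕ→ℚ (d i)) v
      ≈⟨ (λ j → cong₂ _+_ (lincomb-• (ℕ→ℚ a) _ j) (lincomb-• (ℕ→ℚ b) _ j)) ⟩
    lincomb (λ i → ℕ→ℚ a * ℕ→ℚ (c i)) v +ᵥ lincomb (λ i → ℕ→ℚ b * ℕ→ℚ (d i)) v
      ≈⟨ lincomb-+ (λ i → ℕ→ℚ a * ℕ→ℚ (c i)) (λ i → ℕ→ℚ b * ℕ→ℚ (d i)) ⟩
    lincomb (λ i → ℕ→ℚ a * ℕ→ℚ (c i) + ℕ→ℚ b * ℕ→ℚ (d i)) v
      ≈⟨ lincomb-cong (λ i → sym (trans (ℕ→ℚ-homo-+ (a ℕ.* c i) (b ℕ.* d i))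
                                         (cong₂ _+_ (ℕ→ℚ-homo-* a (c i)) (ℕ→ℚ-homo-* b (d i))))) ⟩
    lincomb (λ i → ℕ→ℚ (a ℕ.* c i ℕ.+ b ℕ.* d i)) v ∎)
    where open ≈ᵥ-Reasoning n

  ℕ-lincomb-injective : Independent v → ∀ {c d : Fin m → ℕ} →
    lincomb (λ i → ℕ→ℚ (c i)) v ≈ᵥ lincomb (λ i → ℕ→ℚ (d i)) v → ∀ i → c i ≡ d i
  ℕ-lincomb-injective indep {c} {d} c≈d i =
    ℕ→ℚ-injective (lincomb-injective indep {λ i → ℕ→ℚ (c i)} {λ i → ℕ→ℚ (d i)} c≈d i)

  cone-ray : Independent v → ∀ a b k {u w} → InCone u → InCone w →
    u +ᵥ ℕ→ℚ (suc a) • w ≈ᵥ ℕ→ℚ b • v k → Proportional w (v k)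
  cone-ray indep a b k {u} {w} (d , u≈d) (c , w≈c) u+w≈vk = ℕ→ℚ (c k) , (begin
    w                                        ≈⟨ w≈c ⟩
    lincomb (λ i → ℕ→ℚ (c i)) v              ≈⟨ lincomb-cong (cong ℕ→ℚ ∘ supported-single k c c-off-k) ⟩
    lincomb (λ i → ℕ→ℚ (single k (c k) i)) v ≈⟨ lincomb-single v k (c k) ⟩
    ℕ→ℚ (c k) • v k                          ∎)
    where
    open ≈ᵥ-Reasoning n
    e : Fin m → ℕ
    e i = 1 ℕ.* d i ℕ.+ suc a ℕ.* c i
    e≈single : lincomb (λ i → ℕ→ℚ (e i)) v ≈ᵥ lincomb (λ i → ℕ→ℚ (single k b i)) v
    e≈single = begin
      lincomb (λ i → ℕ→ℚ (e i)) v
        ≈⟨ ≈ᵥ-sym (proj₂ (cone-comb 1 (suc a) (d , u≈d) (c , w≈c))) ⟩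
      ℕ→ℚ 1 • u +ᵥ ℕ→ℚ (suc a) • w
        ≈⟨ (λ j → cong (_+ ℕ→ℚ (suc a) * w j) (ℚ.*-identityˡ (u j))) ⟩
      u +ᵥ ℕ→ℚ (suc a) • w
        ≈⟨ u+w≈vk ⟩
      ℕ→ℚ b • v k
        ≈⟨ ≈ᵥ-sym (lincomb-single v k b) ⟩
      lincomb (λ i → ℕ→ℚ (single k b i)) v ∎
    c-off-k : ∀ i → i ≢ k → c i ≡ 0
    c-off-k i i≢k = [ (λ ()) , id ]′ (ℕ.m*n≡0⇒m≡0∨n≡0 (suc a) (ℕ.m+n≡0⇒n≡0 (1 ℕ.* d i) ei≡0))
      where
      ei≡0 : e i ≡ 0
      ei≡0 = trans (ℕ-lincomb-injective indep {e} {single k b} e≈single i) (single-≢ k i b i≢k)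

cone-resp : ∀ {m n} {v : Fin m → Vect n} {u u′} → u ≈ᵥ u′ → InCone v u′ → InCone v u
cone-resp u≈u′ (c , u′≈c) = c , ≈ᵥ-trans u≈u′ u′≈c

-- Root systems

module RootSystemProperties {r : ℕ} (R : RootSystem r) where
  open RS R hiding (⟨_,_⟩; _^∨)
  open Euclidean ip

  root≉0 : ∀ {α} → α ∈ᵥ Φ → ¬ (α ≈ᵥ 0ᵥ)
  root≉0 {α} = Φ-nonzero α

  ∈ᵥ-resp : ∀ {u v} {L : List (Vect r)} → u ≈ᵥ v → v ∈ᵥ L → u ∈ᵥ L
  ∈ᵥ-resp u≈v = Any.map (≈ᵥ-trans u≈v)

  -root : ∀ {α} → α ∈ᵥ Φ → (-ᵥ α) ∈ᵥ Φ
  -root {α} α∈Φ = ∈ᵥ-resp (≈ᵥ-sym (s-self (root≉0 α∈Φ))) (Φ-refl α α α∈Φ α∈Φ)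

  act-cong : ∀ w {u v} → u ≈ᵥ v → act w u ≈ᵥ act w v
  act-cong (weyl []       _)            u≈v = u≈v
  act-cong (weyl (γ ∷ ws) (_ ∷ ws∈Φ)) u≈v = s-cong γ (act-cong (weyl ws ws∈Φ) u≈v)

  act-+ : ∀ w u v → act w (u +ᵥ v) ≈ᵥ act w u +ᵥ act w v
  act-+ (weyl []       _)            u v = ≈ᵥ-refl
  act-+ (weyl (γ ∷ ws) (_ ∷ ws∈Φ)) u v =
    ≈ᵥ-trans (s-cong γ (act-+ (weyl ws ws∈Φ) u v))
             (s-+ γ (act (weyl ws ws∈Φ) u) (act (weyl ws ws∈Φ) v))

  act-• : ∀ w c v → act w (c • v) ≈ᵥ c • act w v
  act-• (weyl []       _)            c v = ≈ᵥ-refl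
  act-• (weyl (γ ∷ ws) (_ ∷ ws∈Φ)) c v =
    ≈ᵥ-trans (s-cong γ (act-• (weyl ws ws∈Φ) c v)) (s-• γ c _)

  act-iso : ∀ w u v → ⟨ act w u , act w v ⟩ ≡ ⟨ u , v ⟩
  act-iso (weyl []       _)               u v = refl
  act-iso (weyl (γ ∷ ws) (γ∈Φ ∷ ws∈Φ)) u v =
    trans (s-iso (root≉0 γ∈Φ) (act (weyl ws ws∈Φ) u) (act (weyl ws ws∈Φ) v))
          (act-iso (weyl ws ws∈Φ) u v)

  act-Φ : ∀ w {α} → α ∈ᵥ Φ → act w α ∈ᵥ Φ
  act-Φ (weyl []       _)               α∈Φ = α∈Φ
  act-Φ (weyl (γ ∷ ws) (γ∈Φ ∷ ws∈Φ)) α∈Φ = Φ-refl γ _ γ∈Φ (act-Φ (weyl ws ws∈Φ) α∈Φ)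

  act-comb : ∀ w a b u v → act w (a • u +ᵥ b • v) ≈ᵥ a • act w u +ᵥ b • act w v
  act-comb w a b u v i =
    trans (act-+ w (a • u) (b • v) i) (cong₂ _+_ (act-• w a u i) (act-• w b v i))

  act-¬proportional : ∀ w {u v} → ¬ Proportional u v → ¬ Proportional (act w u) (act w v)
  act-¬proportional w {u} {v} u∦v (c , wu≈cwv) = ‖‖²≡0⇒¬¬≈0 ‖d‖²≡0 λ d≈0 →
    u∦v (c , λ i → ℚ-Group.x∙y⁻¹≈ε⇒x≈y (u i) (c * v i) (trans (rearrange (u i) c (v i)) (d≈0 i)))
    where
    cancel : ∀ c y → 1ℚ * (c * y) + - c * y ≡ 0ℚ
    cancel = solve-∀ ℚ-ring
    rearrange : ∀ x c y → x - c * y ≡ 1ℚ * x + - c * y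
    rearrange = solve-∀ ℚ-ring
    d = 1ℚ • u +ᵥ (- c) • v
    wd≈0 : act w d ≈ᵥ 0ᵥ
    wd≈0 i = trans (act-comb w 1ℚ (- c) u v i)
      (trans (cong (λ y → 1ℚ * y + - c * act w v i) (wu≈cwv i)) (cancel c (act w v i)))
    ‖d‖²≡0 : ‖ d ‖² ≡ 0ℚ
    ‖d‖²≡0 = trans (sym (act-iso w d d)) (trans (ipr-cong wd≈0 wd≈0) (ipr-0ˡ 0ᵥ))

  record CorootSum (α γ : Vect r) : Set where
    field
      β          : Vect r
      β∈Φ        : β ∈ᵥ Φ
      coroot-sum : α ^∨ +ᵥ γ ^∨ ≈ᵥ β ^∨
      a b        : ℕ
      β≈         : β ≈ᵥ ℕ→ℚ (suc a) • α +ᵥ ℕ→ℚ (suc b) • γ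

  corootSum-sym : ∀ {α γ} → CorootSum γ α → CorootSum α γ
  corootSum-sym {α} {γ} C = record
    { β          = β
    ; β∈Φ        = β∈Φ
    ; coroot-sum = λ i → trans (ℚ.+-comm ((α ^∨) i) ((γ ^∨) i)) (coroot-sum i)
    ; a          = b
    ; b          = a
    ; β≈         = λ i → trans (β≈ i) (ℚ.+-comm (ℕ→ℚ (suc a) * γ i) (ℕ→ℚ (suc b) * α i))
    }
    where open CorootSum C

  negative-cartan-integer : ∀ {α γ} → α ∈ᵥ Φ → γ ∈ᵥ Φ → ⟨ γ , α ^∨ ⟩ < 0ℚ →
    ∃[ m ] ⟨ γ , α ^∨ ⟩ ≡ - ℕ→ℚ (suc m)
  negative-cartan-integer {α} {γ} α∈Φ γ∈Φ γα∨<0 =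
    let z , γα∨≡z = Φ-int α γ α∈Φ γ∈Φ
        m , z≡-m  = ℤ→ℚ-neg {z} (subst (_< 0ℚ) γα∨≡z γα∨<0)
    in m , trans γα∨≡z z≡-m

  reflection-corootSum : ∀ {α γ n} → α ∈ᵥ Φ → γ ∈ᵥ Φ →
    ⟨ γ , α ^∨ ⟩ ≡ - 1ℚ → ⟨ α , γ ^∨ ⟩ ≡ - ℕ→ℚ (suc n) → CorootSum α γ
  reflection-corootSum {α} {γ} {n} α∈Φ γ∈Φ γα∨≡-1 αγ∨≡-n = record
    { β          = s γ α
    ; β∈Φ        = Φ-refl γ α γ∈Φ α∈Φ
    ; coroot-sum = λ i → sym (begin
        (s γ α ^∨) i                            ≡⟨ coroot-s (root≉0 γ∈Φ) α i ⟩
        (α ^∨) i - ⟨ α ^∨ , γ ⟩ * (γ ^∨) i      ≡⟨ cong (λ y → (α ^∨) i - y * (γ ^∨) i)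
                                                         (trans (ipr-sym (α ^∨) γ) γα∨≡-1) ⟩
        (α ^∨) i - (- 1ℚ) * (γ ^∨) i            ≡⟨ add-back ((α ^∨) i) ((γ ^∨) i) ⟩
        (α ^∨) i + (γ ^∨) i                     ∎)
    ; a          = 0
    ; b          = n
    ; β≈         = λ i → begin
        α i - ⟨ α , γ ^∨ ⟩ * γ i                ≡⟨ cong (λ y → α i - y * γ i) αγ∨≡-n ⟩
        α i - (- ℕ→ℚ (suc n)) * γ i             ≡⟨ shift (α i) (ℕ→ℚ (suc n)) (γ i) ⟩
        1ℚ * α i + ℕ→ℚ (suc n) * γ i            ∎
    }
    where
    open ≡-Reasoning
    shift : ∀ a t g → a - (- t) * g ≡ 1ℚ * a + t * g
    shift = solve-∀ ℚ-ring
    add-back : ∀ a g → a - (- 1ℚ) * g ≡ a + g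
    add-back = solve-∀ ℚ-ring

  corootSum : ∀ {α γ} → α ∈ᵥ Φ → γ ∈ᵥ Φ → ¬ Proportional α γ → ⟨ γ , α ^∨ ⟩ < 0ℚ → CorootSum α γ
  corootSum {α} {γ} α∈Φ γ∈Φ α∦γ γα∨<0 = from-cartan-integers (product<4⇒factor≡1 n m cartan-bound)
    where
    γα∨≡-m = negative-cartan-integer α∈Φ γ∈Φ γα∨<0
    αγ∨≡-n = negative-cartan-integer γ∈Φ α∈Φ (coroot-pairing-neg-sym (root≉0 α∈Φ) (root≉0 γ∈Φ) γα∨<0)
    m = proj₁ γα∨≡-m
    n = proj₁ αγ∨≡-n
    cartan-bound : ℕ→ℚ (suc n) * ℕ→ℚ (suc m) < ℕ→ℚ 4
    cartan-bound = subst (_< ℕ→ℚ 4)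
      (trans (cong₂ _*_ (proj₂ αγ∨≡-n) (proj₂ γα∨≡-m)) (neg*neg (ℕ→ℚ (suc n)) (ℕ→ℚ (suc m))))
      (cartan-product<4 (root≉0 α∈Φ) (root≉0 γ∈Φ) α∦γ)
      where
      neg*neg : ∀ x y → - x * - y ≡ x * y
      neg*neg = solve-∀ ℚ-ring
    from-cartan-integers : n ≡ 0 ⊎ m ≡ 0 → CorootSum α γ
    from-cartan-integers (inj₁ n≡0) = corootSum-sym (reflection-corootSum {γ} {α} {m} γ∈Φ α∈Φ
      (trans (proj₂ αγ∨≡-n) (cong (λ k → - ℕ→ℚ (suc k)) n≡0)) (proj₂ γα∨≡-m))
    from-cartan-integers (inj₂ m≡0) = reflection-corootSum {α} {γ} {n} α∈Φ γ∈Φ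
      (trans (proj₂ γα∨≡-m) (cong (λ k → - ℕ→ℚ (suc k)) m≡0)) (proj₂ αγ∨≡-n)

  positive-comb⇒proportional : ∀ a b k {x y z} → InCone Δ (-ᵥ x) → y ≈ᵥ Δ k → InCone Δ z →
    z ≈ᵥ ℕ→ℚ (suc a) • x +ᵥ ℕ→ℚ (suc b) • y → Proportional x y
  positive-comb⇒proportional a b k {x} {y} {z} cone-x y≈Δk cone-z z≈ =
    - proj₁ ray , λ i → begin
      x i               ≡⟨ ℚ-Group.⁻¹-involutive (x i) ⟨
      - (- x i)         ≡⟨ cong -_ (proj₂ ray i) ⟩
      - (t * Δ k i)     ≡⟨ cong (λ y → - (t * y)) (y≈Δk i) ⟨
      - (t * y i)       ≡⟨ ℚ.neg-distribˡ-* t (y i) ⟩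
      - t * y i         ∎
    where
    open ≡-Reasoning
    A = ℕ→ℚ (suc a)
    B = ℕ→ℚ (suc b)
    cancel : ∀ A B x y → A * x + B * y + A * - x ≡ B * y
    cancel = solve-∀ ℚ-ring
    ray : Proportional (-ᵥ x) (Δ k)
    ray = cone-ray Δ Δ-indep a (suc b) k cone-z cone-x λ i → begin
      z i + A * - x i              ≡⟨ cong (_+ A * - x i) (z≈ i) ⟩
      A * x i + B * y i + A * - x i ≡⟨ cancel A B (x i) (y i) ⟩
      B * y i                      ≡⟨ cong (B *_) (y≈Δk i) ⟩
      B * Δ k i                    ∎
    t = proj₁ ray

  act-comb-neg : ∀ w {α γ β} a b → (∃[ k ] act w γ ≈ᵥ Δ k) ⊎ Neg (act w γ) → Neg (act w α) →
    ¬ Proportional α γ → β ∈ᵥ Φ → β ≈ᵥ ℕ→ℚ (suc a) • α +ᵥ ℕ→ℚ (suc b) • γ → Neg (act w β)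
  act-comb-neg w {α} {γ} {β} a b wγ-simple-or-neg (_ , cone-α) α∦γ β∈Φ β≈ =
    -root (act-Φ w β∈Φ) , cone-β wγ-simple-or-neg
    where
    A = ℕ→ℚ (suc a)
    B = ℕ→ℚ (suc b)
    wβ≈ : act w β ≈ᵥ A • act w α +ᵥ B • act w γ
    wβ≈ = ≈ᵥ-trans (act-cong w β≈) (act-comb w A B α γ)
    negate : ∀ A B x y → - (A * x + B * y) ≡ A * - x + B * - y
    negate = solve-∀ ℚ-ring
    from-span : ∀ k → act w γ ≈ᵥ Δ k →
      Σ (Fin r → ℕ) (λ c → act w β ≈ᵥ lincomb (λ i → ℕ→ℚ (c i)) Δ
                         ⊎ act w β ≈ᵥ -ᵥ lincomb (λ i → ℕ→ℚ (c i)) Δ) →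
      InCone Δ (-ᵥ act w β)
    from-span k wγ≈Δk (c , inj₁ wβ≈c) = ⊥-elim (act-¬proportional w α∦γ
      (positive-comb⇒proportional a b k cone-α wγ≈Δk (c , wβ≈c) wβ≈))
    from-span k wγ≈Δk (c , inj₂ wβ≈-c) =
      c , λ i → trans (cong -_ (wβ≈-c i)) (ℚ-Group.⁻¹-involutive _)
    cone-β : (∃[ k ] act w γ ≈ᵥ Δ k) ⊎ Neg (act w γ) → InCone Δ (-ᵥ act w β)
    cone-β (inj₁ (k , wγ≈Δk)) = from-span k wγ≈Δk (Δ-span (act w β) (act-Φ w β∈Φ))
    cone-β (inj₂ (_ , cone-γ)) = cone-resp
      (λ i → trans (cong -_ (wβ≈ i)) (negate A B (act w α i) (act w γ i)))
      (cone-comb Δ (suc a) (suc b) cone-α cone-γ)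

-- The parabolic subsystem Φ_p

module Parabolic {r : ℕ} (R : RootSystem r) (λs : Fin r → Vect r) (p : Fin r)
                 (fund : RS.IsFundWeights R λs) where
  open RS R hiding (⟨_,_⟩; _^∨)
  open Euclidean ip
  open RootSystemProperties R

  λp-coroot-p : ⟨ λs p , Δ p ^∨ ⟩ ≡ 1ℚ
  λp-coroot-p with p Fin.≟ p | fund p p
  ... | yes _   | λp≡1 = λp≡1
  ... | no p≢p | _    = ⊥-elim (p≢p refl)

  λp-coroot-≢ : ∀ {j} → j ≢ p → ⟨ λs p , Δ j ^∨ ⟩ ≡ 0ℚ
  λp-coroot-≢ {j} j≢p with p Fin.≟ j | fund p j
  ... | yes p≡j | _    = ⊥-elim (j≢p (sym p≡j))
  ... | no _    | λp≡0 = λp≡0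

  λp-simple : ∀ j → ⟨ λs p , Δ j ⟩ ≡ ½ * ‖ Δ j ‖² * ⟨ λs p , Δ j ^∨ ⟩
  λp-simple j = pairing-via-coroot (root≉0 (Δ-root j)) (λs p)

  λp-simple-≢ : ∀ {j} → j ≢ p → ⟨ λs p , Δ j ⟩ ≡ 0ℚ
  λp-simple-≢ {j} j≢p =
    trans (λp-simple j)
          (trans (cong (½ * ‖ Δ j ‖² *_) (λp-coroot-≢ j≢p)) (ℚ.*-zeroʳ (½ * ‖ Δ j ‖²)))

  λp-simple-p-pos : 0ℚ < ⟨ λs p , Δ p ⟩
  λp-simple-p-pos = subst (0ℚ <_) (sym (λp-simple p))
    (pos*pos⇒pos′ (pos*pos⇒pos′ (ℚ.positive⁻¹ ½) (‖‖²-pos (root≉0 (Δ-root p))))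
                  (subst (0ℚ <_) (sym λp-coroot-p) (ℚ.positive⁻¹ 1ℚ)))

  λp-simple-nonNeg : ∀ j → 0ℚ ≤ ⟨ λs p , Δ j ⟩
  λp-simple-nonNeg j with j Fin.≟ p
  ... | yes refl = ℚ.<⇒≤ λp-simple-p-pos
  ... | no j≢p  = ℚ.≤-reflexive (sym (λp-simple-≢ j≢p))

  -- ⟨ λ_p , - ⟩ vanishes on γ, is nonnegative on every simple root and positive on α_p.
  Φp-coefficient-p : ∀ {γ} (c : Fin r → ℕ) → γ ∈ᵥ Φ → ⟨ λs p , γ ^∨ ⟩ ≡ 0ℚ →
    γ ≈ᵥ lincomb (λ i → ℕ→ℚ (c i)) Δ → c p ≡ 0
  Φp-coefficient-p {γ} c γ∈Φ λpγ∨≡0 γ≈c = vanishing (c p) refl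
    where
    λpγ≡0 : ⟨ λs p , γ ⟩ ≡ 0ℚ
    λpγ≡0 = trans (pairing-via-coroot (root≉0 γ∈Φ) (λs p))
                  (trans (cong (½ * ‖ γ ‖² *_) λpγ∨≡0) (ℚ.*-zeroʳ (½ * ‖ γ ‖²)))
    sum≡0 : sumFin (λ i → ℕ→ℚ (c i) * ⟨ λs p , Δ i ⟩) ≡ 0ℚ
    sum≡0 = trans (sym (ipr-lincombʳ (λ i → ℕ→ℚ (c i)) Δ (λs p)))
                  (trans (ipr-cong {λs p} ≈ᵥ-refl (≈ᵥ-sym γ≈c)) λpγ≡0)
    vanishing : ∀ k → c p ≡ k → k ≡ 0
    vanishing zero    _      = refl
    vanishing (suc k) cp≡1+k = ⊥-elim (ℚ.<-irrefl (sym sum≡0)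
      (sumFin-pos _ (λ i → nonNeg*nonNeg⇒nonNeg′ (ℕ→ℚ-nonNeg (c i)) (λp-simple-nonNeg i)) p
        (pos*pos⇒pos′ (subst (λ k → 0ℚ < ℕ→ℚ k) (sym cp≡1+k) (ℕ→ℚ-pos k)) λp-simple-p-pos)))

  ρp-pairing<0⇒∃simple<0 : ∀ {ρp} → IsRhoP λs p ρp → ∀ v → ⟨ ρp , v ⟩ < 0ℚ →
    ∃[ j ] (j ≢ p × ⟨ Δ j , v ⟩ < 0ℚ)
  ρp-pairing<0⇒∃simple<0 {ρp} (L , _ , L↔Φp⁺ , ρp≈) v ρpv<0 =
    let γ , γ∈L , γv<0 = ipr-sumᵥ<0⇒∃<0 L v (nonNeg*x<0⇒x<0 (ℚ.<⇒≤ (ℚ.positive⁻¹ ½))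
                           (subst (_< 0ℚ) (trans (ipr-cong ρp≈ ≈ᵥ-refl) (ipr-•ˡ ½ (sumᵥ L) v)) ρpv<0))
        (γ∈Φ , λpγ∨≡0) , (_ , c , γ≈c) = Equivalence.to (L↔Φp⁺ γ) γ∈L
        j , cj≢0 , Δjv<0 = ipr-lincomb<0⇒∃<0 c Δ v (subst (_< 0ℚ) (ipr-cong γ≈c ≈ᵥ-refl) γv<0)
    in j , (λ j≡p → cj≢0 (trans (cong c j≡p) (Φp-coefficient-p c γ∈Φ λpγ∨≡0 γ≈c))) , Δjv<0

  PosNotΦp⇒λp≢0 : ∀ {α} → PosNotΦp λs p α → ⟨ λs p , α ^∨ ⟩ ≢ 0ℚ
  PosNotΦp⇒λp≢0 (α⁺ , α∉Φp⁺) λpα∨≡0 = α∉Φp⁺ ((proj₁ α⁺ , λpα∨≡0) , α⁺)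

  ¬proportional-simple : ∀ {α j} → PosNotΦp λs p α → j ≢ p → ¬ Proportional α (Δ j)
  ¬proportional-simple hα j≢p (c , α≈cΔj) =
    PosNotΦp⇒λp≢0 hα (pairing-coroot-proportional {λs p} {c = c} (λp-simple-≢ j≢p) α≈cΔj)

  corootSum-posNotΦp : ∀ {α j} → PosNotΦp λs p α → j ≢ p → (C : CorootSum α (Δ j)) →
    PosNotΦp λs p (CorootSum.β C)
  corootSum-posNotΦp {α} {j} hα@((_ , cone-α) , _) j≢p C =
    (β∈Φ , cone-resp β≈ (cone-comb Δ (suc a) (suc b) cone-α (cone-generator Δ j))) ,
    λ ((_ , λpβ∨≡0) , _) → PosNotΦp⇒λp≢0 hα (begin
      ⟨ λs p , α ^∨ ⟩                          ≡⟨ ℚ.+-identityʳ _ ⟨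
      ⟨ λs p , α ^∨ ⟩ + 0ℚ                     ≡⟨ cong (⟨ λs p , α ^∨ ⟩ +_) (λp-coroot-≢ j≢p) ⟨
      ⟨ λs p , α ^∨ ⟩ + ⟨ λs p , Δ j ^∨ ⟩      ≡⟨ ipr-+ʳ (λs p) (α ^∨) (Δ j ^∨) ⟨
      ⟨ λs p , α ^∨ +ᵥ Δ j ^∨ ⟩                ≡⟨ ipr-cong {λs p} ≈ᵥ-refl coroot-sum ⟩
      ⟨ λs p , β ^∨ ⟩                          ≡⟨ λpβ∨≡0 ⟩
      0ℚ                                       ∎)
    where
    open ≡-Reasoning
    open CorootSum C

  simple-corootSum : ∀ {ρp α} → IsRhoP λs p ρp → PosNotΦp λs p α → ⟨ ρp , α ^∨ ⟩ < 0ℚ →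
    ∃[ j ] (j ≢ p × CorootSum α (Δ j))
  simple-corootSum {α = α} ρp-def α∈Φ⁺∖Φp⁺ ρα∨<0 =
    let j , j≢p , Δjα∨<0 = ρp-pairing<0⇒∃simple<0 ρp-def (α ^∨) ρα∨<0
    in j , j≢p ,
       corootSum (proj₁ (proj₁ α∈Φ⁺∖Φp⁺)) (Δ-root j) (¬proportional-simple α∈Φ⁺∖Φp⁺ j≢p) Δjα∨<0

lemma8p2 : ∀ {r : ℕ} (R : RootSystem r) (λs : Fin r → Vect r) (p : Fin r) (ρp : Vect r) →
    let open RS R in
    IsFundWeights λs → IsRhoP λs p ρp →
    (∀ α → PosNotΦp λs p α → ⟨ ρp , α ^∨ ⟩ < 0ℚ →
      ∃[ j ] (j ≢ p × ∃[ β ] (PosNotΦp λs p β × (α ^∨ +ᵥ (Δ j) ^∨) ≈ᵥ β ^∨)))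
    ×
    (∀ (w : WeylElt) → InWp p w →
      ∀ α → PosNotΦp λs p α → InInvNeg w α → ⟨ ρp , α ^∨ ⟩ < 0ℚ →
      ∃[ j ] (j ≢ p × ∃[ β ] ((PosNotΦp λs p β × InInvNeg w β) × (α ^∨ +ᵥ (Δ j) ^∨) ≈ᵥ β ^∨)))
lemma8p2 R λs p ρp fund ρp-def =
    (λ α α∈Φ⁺∖Φp⁺ ρα∨<0 → part₁ α∈Φ⁺∖Φp⁺ (simple-corootSum ρp-def α∈Φ⁺∖Φp⁺ ρα∨<0))
  , (λ w w∈𝔚p α α∈Φ⁺∖Φp⁺ wα<0 ρα∨<0 →
       part₂ w w∈𝔚p α∈Φ⁺∖Φp⁺ wα<0 (simple-corootSum ρp-def α∈Φ⁺∖Φp⁺ ρα∨<0))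
  where
  open RS R hiding (⟨_,_⟩; _^∨)
  open Euclidean ip
  open RootSystemProperties R
  open Parabolic R λs p fund

  part₁ : ∀ {α} → PosNotΦp λs p α → ∃[ j ] (j ≢ p × CorootSum α (Δ j)) →
    ∃[ j ] (j ≢ p × ∃[ β ] (PosNotΦp λs p β × (α ^∨ +ᵥ Δ j ^∨) ≈ᵥ β ^∨))
  part₁ α∈Φ⁺∖Φp⁺ (j , j≢p , C) = j , j≢p , β , corootSum-posNotΦp α∈Φ⁺∖Φp⁺ j≢p C , coroot-sum
    where open CorootSum C

  part₂ : ∀ w → InWp p w → ∀ {α} → PosNotΦp λs p α → InInvNeg w α →
    ∃[ j ] (j ≢ p × CorootSum α (Δ j)) →
    ∃[ j ] (j ≢ p × ∃[ β ] ((PosNotΦp λs p β × InInvNeg w β) × (α ^∨ +ᵥ Δ j ^∨) ≈ᵥ β ^∨))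
  part₂ w w∈𝔚p α∈Φ⁺∖Φp⁺ wα<0 (j , j≢p , C) =
    j , j≢p , β ,
    (corootSum-posNotΦp α∈Φ⁺∖Φp⁺ j≢p C ,
     act-comb-neg w a b (w∈𝔚p j j≢p) wα<0 (¬proportional-simple α∈Φ⁺∖Φp⁺ j≢p) β∈Φ β≈) ,
    coroot-sum
    where open CorootSum C
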